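{- The functions $\upharpoonright(x/a)=a\upharpoonright x=\{\langle z,a'z\rangle: z\in x\}$ and $rng(x/a)=a''x$ (one normal argument $x$, one safe argument $a$) are in ${\sf PCSF}$.
   Context: Ordered pairs are Kuratowski pairs $\langle c,d\rangle=\{\{c\},\{c,d\}\}$; $b'c=\bigcup\{d:\langle c,d\rangle\in b\}$ and $b''a=\{b'c: c\in a\}$. Functions are set-theoretic functions on the universe of sets, written $f(x_1,\ldots,x_n/a_1,\ldots,a_m)$: arguments before the slash are called normal, after it safe (either list may be empty, written $-$). The class ${\sf PCSF}^-$ consists of functions with no normal arguments; it contains the projections $\pi^{ -,m}_j(-/a_1,\ldots,a_m)=a_j$, $\mathrm{pair}(-/a,b)=\{a,b\}$, $\mathrm{null}(-/-)=\emptyset$, $\mathrm{union}(-/a)=\bigcup a$, and $\mathrm{Cond}_\in(-/a,b,c,d)$, which equals $a$ if $c\in d$ and $b$ otherwise; and it is closed under composition $f(-/\vec a)=h(-/t_1(-/\vec a),\ldots,t_k(-/\vec a))$ and under safe separation: if $h(-/\vec a,b)\in{\sf PCSF}^-$ then $f(-/\vec a,c)=\{b\in c: h(-/\vec a,b)\neq\emptyset\}\in{\sf PCSF}^-$. The class ${\sf PCSF}$ is the smallest class containing ${\sf PCSF}^-$ and all projections $\pi^{n,m}_j(x_1,\ldots,x_n/x_{n+1},\ldots,x_{n+m})=x_j$, and closed under safe composition $f(\vec x/\vec a)=h(r_1(\vec x/-),\ldots,r_k(\vec x/-)/t_1(\vec x/\vec a),\ldots,t_l(\vec x/\vec a))$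 (with $h,r_i,t_j\in{\sf PCSF}$, the $r_i$ having no safe arguments) and predicative set recursion $f(x,\vec y/\vec a)=h(x,\vec y/\vec a,\{f(z,\vec y/\vec a): z\in x\})$ (with $h\in{\sf PCSF}$). -}

module Defs where

open import Level using (Level; suc; _⊔_)
open import Data.Nat using (ℕ; _+_) renaming (suc to sucℕ)
open import Data.Fin using (Fin)
open import Data.Vec using (Vec; []; _∷_; _∷ʳ_; _++_; lookup; tabulate)
open import Data.Product using (Σ; _×_; _,_)
open import Data.Sum using (_⊎_; inj₁; inj₂)
open import Relation.Nullary using (¬_)
open import Relation.Binary.PropositionalEquality using (_≡_)
open import Induction.WellFounded using (WellFounded)

record SetModel (ℓ : Level) : Set (suc ℓ) where
  field
    V    : Set ℓ
    _∈_  : V → V → Set ℓ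
    ext  : ∀ a b → (∀ z → (z ∈ a → z ∈ b) × (z ∈ b → z ∈ a)) → a ≡ b
    ∅    : V
    ∅-ax : ∀ z → ¬ (z ∈ ∅)
    pair : V → V → V
    pair-ax : ∀ a b z → (z ∈ pair a b → (z ≡ a ⊎ z ≡ b)) × ((z ≡ a ⊎ z ≡ b) → z ∈ pair a b)
    ⋃    : V → V
    ⋃-ax : ∀ a z → (z ∈ ⋃ a → Σ V λ y → y ∈ a × z ∈ y) × ((Σ V λ y → y ∈ a × z ∈ y) → z ∈ ⋃ a)
    sep  : V → (V → Set ℓ) → V
    sep-ax : ∀ a P z → (z ∈ sep a P → (z ∈ a × P z)) × ((z ∈ a × P z) → z ∈ sep a P)
    repl : (V → V) → V → V
    repl-ax : ∀ f a z → (z ∈ repl f a → Σ V λ y → y ∈ a × z ≡ f y) × ((Σ V λ y → y ∈ a × z ≡ f y) → z ∈ repl f a)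
    wf   : WellFounded _∈_
    em   : (P : Set ℓ) → P ⊎ ¬ P

module Sets {ℓ : Level} (M : SetModel ℓ) where
  open SetModel M

  condAux : V → V → (c d : V) → (c ∈ d) ⊎ ¬ (c ∈ d) → V
  condAux a b c d (inj₁ _) = a
  condAux a b c d (inj₂ _) = b

  cond : V → V → V → V → V
  cond a b c d = condAux a b c d (em (c ∈ d))

  opair : V → V → V
  opair c d = pair (pair c c) (pair c d)

  -- b'c = ⋃ { d : ⟨c,d⟩ ∈ b }   (such d lie in ⋃⋃b)
  app : V → V → V
  app b c = ⋃ (sep (⋃ (⋃ b)) (λ d → opair c d ∈ b))

  restrict : V → V → V
  restrict x a = repl (λ z → opair z (app a z)) x

  rng : V → V → V
  rng x a = repl (app a) x

  restrictF : Vec V 1 → Vec V 1 → V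
  restrictF (x ∷ []) (a ∷ []) = restrict x a

  rngF : Vec V 1 → Vec V 1 → V
  rngF (x ∷ []) (a ∷ []) = rng x a

  -- PCSF⁻ : functions with only safe arguments (m of them)
  data PCSF⁻ : {m : ℕ} → (Vec V m → V) → Set ℓ where
    proj⁻  : ∀ {m} {f : Vec V m → V} (j : Fin m) →
             (∀ as → f as ≡ lookup as j) → PCSF⁻ f
    pair⁻  : {f : Vec V 2 → V} → (∀ a b → f (a ∷ b ∷ []) ≡ pair a b) → PCSF⁻ f
    null⁻  : {f : Vec V 0 → V} → f [] ≡ ∅ → PCSF⁻ f
    union⁻ : {f : Vec V 1 → V} → (∀ a → f (a ∷ []) ≡ ⋃ a) → PCSF⁻ f
    cond⁻  : {f : Vec V 4 → V} →
             (∀ a b c d → f (a ∷ b ∷ c ∷ d ∷ []) ≡ cond a b c d) → PCSF⁻ f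
    comp⁻  : ∀ {m k} {f : Vec V m → V} {h : Vec V k → V} {ts : Fin k → Vec V m → V} →
             PCSF⁻ h → (∀ i → PCSF⁻ (ts i)) →
             (∀ as → f as ≡ h (tabulate (λ i → ts i as))) → PCSF⁻ f
    sep⁻   : ∀ {m} {f : Vec V (sucℕ m) → V} {h : Vec V (sucℕ m) → V} →
             PCSF⁻ h →
             (∀ (as : Vec V m) c → f (as ∷ʳ c) ≡ sep c (λ b → ¬ (h (as ∷ʳ b) ≡ ∅))) →
             PCSF⁻ f

  -- PCSF n m : functions with n normal and m safe arguments
  data PCSF : (n m : ℕ) → (Vec V n → Vec V m → V) → Set ℓ where
    base : ∀ {m} {f : Vec V 0 → Vec V m → V} {g : Vec V m → V} →
           PCSF⁻ g → (∀ as → f [] as ≡ g as) → PCSF 0 m f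
    proj : ∀ {n m} {f : Vec V n → Vec V m → V} (j : Fin (n + m)) →
           (∀ xs as → f xs as ≡ lookup (xs ++ as) j) → PCSF n m f
    scomp : ∀ {n m k l} {f : Vec V n → Vec V m → V} {h : Vec V k → Vec V l → V}
              {rs : Fin k → Vec V n → Vec V 0 → V} {ts : Fin l → Vec V n → Vec V m → V} →
            PCSF k l h → (∀ i → PCSF n 0 (rs i)) → (∀ j → PCSF n m (ts j)) →
            (∀ xs as → f xs as ≡ h (tabulate (λ i → rs i xs [])) (tabulate (λ j → ts j xs as))) →
            PCSF n m f
    rec  : ∀ {n m} {f : Vec V (sucℕ n) → Vec V m → V} {h : Vec V (sucℕ n) → Vec V (sucℕ m) → V} →
           PCSF (sucℕ n) (sucℕ m) h →
           (∀ x ys as → f (x ∷ ys) as ≡ h (x ∷ ys) (as ∷ʳ repl (λ z → f (z ∷ ys) as) x)) →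
           PCSF (sucℕ n) m f

module Submission where

-- PCSF⁻ has no replacement, so the only way to form {⟨z, a'z⟩ : z ∈ x} is predicative set
-- recursion on x.  Recursing on a ↾ x itself does not work: from {a ↾ z : z ∈ x} the pairs
-- ⟨z, a'z⟩ for z ∈ x cannot be recovered.  Instead we recurse on the restriction to the
-- successor x ∪ {x}:
--     a ↾ (x ∪ {x}) = the pairs of ⋃{a ↾ (z ∪ {z}) : z ∈ x} ∪ {⟨x, a'x⟩} with first coordinate in x ∪ {x},
-- and recover a ↾ x from a ↾ (x ∪ {x}) by the same first-coordinate filter.  The range is then
-- the relational image of x under the relation a ↾ x, which is definable by separation.

open import Defs
open import Level using (Level)
open import Data.Product using (_×_; _,_; Σ; proj₁; proj₂)
open import Data.Sum using (_⊎_; inj₁; inj₂)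
open import Data.Empty using (⊥-elim)
open import Data.Fin using (Fin; zero; suc)
open import Data.Nat using (_+_) renaming (suc to sucℕ)
open import Data.Vec using (Vec; []; _∷_; _∷ʳ_; _++_; lookup)
open import Data.Vec.Properties using (tabulate∘lookup)
open import Relation.Nullary using (¬_)
open import Relation.Binary.PropositionalEquality using (_≡_; refl; sym; trans; cong; subst)

module Construction {ℓ : Level} (M : SetModel ℓ) where
  open SetModel M
  open Sets M

  ext′ : ∀ {a b} → (∀ z → z ∈ a → z ∈ b) → (∀ z → z ∈ b → z ∈ a) → a ≡ b
  ext′ {a} {b} to from = ext a b (λ z → to z , from z)

  pairI₁ : ∀ {a b} → a ∈ pair a b
  pairI₁ {a} {b} = proj₂ (pair-ax a b a) (inj₁ refl)

  pairI₂ : ∀ {a b} → b ∈ pair a b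
  pairI₂ {a} {b} = proj₂ (pair-ax a b b) (inj₂ refl)

  pairE : ∀ {a b z} → z ∈ pair a b → z ≡ a ⊎ z ≡ b
  pairE {a} {b} {z} = proj₁ (pair-ax a b z)

  ⋃I : ∀ {a y z} → y ∈ a → z ∈ y → z ∈ ⋃ a
  ⋃I {a} {y} {z} y∈a z∈y = proj₂ (⋃-ax a z) (y , y∈a , z∈y)

  ⋃E : ∀ {a z} → z ∈ ⋃ a → Σ V λ y → y ∈ a × z ∈ y
  ⋃E {a} {z} = proj₁ (⋃-ax a z)

  sepI : ∀ {a P z} → z ∈ a → P z → z ∈ sep a P
  sepI {a} {P} {z} z∈a Pz = proj₂ (sep-ax a P z) (z∈a , Pz)

  sepE : ∀ {a P z} → z ∈ sep a P → z ∈ a × P z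
  sepE {a} {P} {z} = proj₁ (sep-ax a P z)

  replI : ∀ {f a y} → y ∈ a → f y ∈ repl f a
  replI {f} {a} {y} y∈a = proj₂ (repl-ax f a (f y)) (y , y∈a , refl)

  replE : ∀ {f a z} → z ∈ repl f a → Σ V λ y → y ∈ a × z ≡ f y
  replE {f} {a} {z} = proj₁ (repl-ax f a z)

  sep-cong : ∀ {c} {P Q : V → Set ℓ} → (∀ z → P z → Q z) → (∀ z → Q z → P z) → sep c P ≡ sep c Q
  sep-cong P⇒Q Q⇒P = ext′ (λ z z∈ → let (z∈c , Pz) = sepE z∈ in sepI z∈c (P⇒Q z Pz))
                          (λ z z∈ → let (z∈c , Qz) = sepE z∈ in sepI z∈c (Q⇒P z Qz))

  member⇒≢∅ : ∀ {w s} → w ∈ s → ¬ (s ≡ ∅)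
  member⇒≢∅ {w} w∈s s≡∅ = ∅-ax w (subst (w ∈_) s≡∅ w∈s)

  ≢∅⇒member : ∀ s → ¬ (s ≡ ∅) → Σ V λ w → w ∈ s
  ≢∅⇒member s s≢∅ with em (Σ V λ w → w ∈ s)
  ... | inj₁ witness = witness
  ... | inj₂ empty = ⊥-elim (s≢∅ (ext′ (λ z z∈s → ⊥-elim (empty (z , z∈s)))
                                       (λ z z∈∅ → ⊥-elim (∅-ax z z∈∅))))

  adjoin : V → V → V
  adjoin s p = ⋃ (pair s (pair p p))

  adjoinI₁ : ∀ {s p z} → z ∈ s → z ∈ adjoin s p
  adjoinI₁ z∈s = ⋃I pairI₁ z∈s

  adjoinI₂ : ∀ {s p} → p ∈ adjoin s p
  adjoinI₂ = ⋃I pairI₂ pairI₁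

  adjoinE : ∀ {s p z} → z ∈ adjoin s p → z ∈ s ⊎ z ≡ p
  adjoinE {s} {p} z∈ with ⋃E z∈
  ... | y , y∈ , z∈y with pairE y∈
  ...   | inj₁ refl = inj₁ z∈y
  ...   | inj₂ refl with pairE z∈y
  ...     | inj₁ z≡p = inj₂ z≡p
  ...     | inj₂ z≡p = inj₂ z≡p

  succ : V → V
  succ x = adjoin x x

  singleton-elim : ∀ {w c} → c ∈ pair w w → w ≡ c
  singleton-elim c∈ with pairE c∈
  ... | inj₁ c≡w = sym c≡w
  ... | inj₂ c≡w = sym c≡w

  singleton∈opair : ∀ {w c d} → pair w w ∈ opair c d → w ≡ c
  singleton∈opair {w} {c} {d} p = singleton-elim (c∈ (pairE p))
    where
      c∈ : pair w w ≡ pair c c ⊎ pair w w ≡ pair c d → c ∈ pair w w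
      c∈ (inj₁ eq) = subst (c ∈_) (sym eq) pairI₁
      c∈ (inj₂ eq) = subst (c ∈_) (sym eq) pairI₁

  pair∈opair : ∀ {c d e} → pair c e ∈ opair c d → e ≡ c ⊎ e ≡ d
  pair∈opair {c} {d} {e} p with pairE p
  ... | inj₂ eq = pairE (subst (e ∈_) eq pairI₂)
  ... | inj₁ eq with pairE (subst (e ∈_) eq pairI₂)
  ...   | inj₁ e≡c = inj₁ e≡c
  ...   | inj₂ e≡c = inj₁ e≡c

  opair-inj₂ : ∀ {c d c′ e} → opair c d ≡ opair c′ e → d ≡ e
  opair-inj₂ {c} {d} {c′} {e} eq with singleton∈opair {c} {c′} {e} (subst (pair c c ∈_) eq pairI₁)
  ... | refl with pair∈opair {c} {e} {d} (subst (pair c d ∈_) eq pairI₂)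
                | pair∈opair {c} {d} {e} (subst (pair c e ∈_) (sym eq) pairI₂)
  ...   | inj₂ d≡e | _        = d≡e
  ...   | _        | inj₂ e≡d = sym e≡d
  ...   | inj₁ d≡c | inj₁ e≡c = trans d≡c (sym e≡c)

  -- Membership test: test c d is nonempty exactly when c ∈ d.  This is how Cond_∈ turns
  -- membership into the "≠ ∅" predicates that safe separation accepts.
  one : V
  one = pair ∅ ∅

  test : V → V → V
  test c d = cond one ∅ c d

  test-≢∅ : ∀ {c d} → c ∈ d → ¬ (test c d ≡ ∅)
  test-≢∅ {c} {d} c∈d = decide (em (c ∈ d))
    where
      decide : (e : c ∈ d ⊎ ¬ (c ∈ d)) → ¬ (condAux one ∅ c d e ≡ ∅)
      decide (inj₁ _)   = member⇒≢∅ (pairI₁ {∅} {∅})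
      decide (inj₂ c∉d) = ⊥-elim (c∉d c∈d)

  test-≢∅⇒∈ : ∀ {c d} → ¬ (test c d ≡ ∅) → c ∈ d
  test-≢∅⇒∈ {c} {d} = decide (em (c ∈ d))
    where
      decide : (e : c ∈ d ⊎ ¬ (c ∈ d)) → ¬ (condAux one ∅ c d e ≡ ∅) → c ∈ d
      decide (inj₁ c∈d) _   = c∈d
      decide (inj₂ _)   ≢∅ = ⊥-elim (≢∅ refl)

  fun₁ : (V → V) → Vec V 1 → V
  fun₁ f (a ∷ []) = f a

  fun₂ : (V → V → V) → Vec V 2 → V
  fun₂ f (a ∷ b ∷ []) = f a b

  fun₃ : (V → V → V → V) → Vec V 3 → V
  fun₃ f (a ∷ b ∷ c ∷ []) = f a b c

  fun₄ : (V → V → V → V → V) → Vec V 4 → V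
  fun₄ f (a ∷ b ∷ c ∷ d ∷ []) = f a b c d

  arg : ∀ {m} (j : Fin m) → PCSF⁻ (λ (as : Vec V m) → lookup as j)
  arg j = proj⁻ j (λ _ → refl)

  resp⁻ : ∀ {m} {f g : Vec V m → V} → PCSF⁻ f → (∀ as → g as ≡ f as) → PCSF⁻ g
  resp⁻ {f = f} pf g≗f =
    comp⁻ {h = f} {ts = λ i as → lookup as i} pf arg
      (λ as → trans (g≗f as) (cong f (sym (tabulate∘lookup as))))

  comp₁ : ∀ {m} {h : V → V} {t : Vec V m → V} →
          PCSF⁻ (fun₁ h) → PCSF⁻ t → PCSF⁻ (λ as → h (t as))
  comp₁ {t = t} ph pt = comp⁻ {ts = λ { zero → t }} ph (λ { zero → pt }) (λ _ → refl)

  comp₂ : ∀ {m} {h : V → V → V} {t u : Vec V m → V} →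
          PCSF⁻ (fun₂ h) → PCSF⁻ t → PCSF⁻ u → PCSF⁻ (λ as → h (t as) (u as))
  comp₂ {t = t} {u} ph pt pu =
    comp⁻ {ts = λ { zero → t ; (suc zero) → u }} ph (λ { zero → pt ; (suc zero) → pu }) (λ _ → refl)

  comp₃ : ∀ {m} {h : V → V → V → V} {t u v : Vec V m → V} →
          PCSF⁻ (fun₃ h) → PCSF⁻ t → PCSF⁻ u → PCSF⁻ v → PCSF⁻ (λ as → h (t as) (u as) (v as))
  comp₃ {t = t} {u} {v} ph pt pu pv =
    comp⁻ {ts = λ { zero → t ; (suc zero) → u ; (suc (suc zero)) → v }} ph
      (λ { zero → pt ; (suc zero) → pu ; (suc (suc zero)) → pv }) (λ _ → refl)

  comp₄ : ∀ {m} {h : V → V → V → V → V} {t u v w : Vec V m → V} →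
          PCSF⁻ (fun₄ h) → PCSF⁻ t → PCSF⁻ u → PCSF⁻ v → PCSF⁻ w →
          PCSF⁻ (λ as → h (t as) (u as) (v as) (w as))
  comp₄ {t = t} {u} {v} {w} ph pt pu pv pw =
    comp⁻ {ts = λ { zero → t ; (suc zero) → u ; (suc (suc zero)) → v ; (suc (suc (suc zero))) → w }} ph
      (λ { zero → pt ; (suc zero) → pu ; (suc (suc zero)) → pv ; (suc (suc (suc zero))) → pw }) (λ _ → refl)

  nullC : ∀ {m} → PCSF⁻ (λ (as : Vec V m) → ∅)
  nullC = comp⁻ {h = λ _ → ∅} {ts = λ ()} (null⁻ refl) (λ ()) (λ _ → refl)

  pairC : ∀ {m} {t u : Vec V m → V} → PCSF⁻ t → PCSF⁻ u → PCSF⁻ (λ as → pair (t as) (u as))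
  pairC = comp₂ (pair⁻ (λ _ _ → refl))

  unionC : ∀ {m} {t : Vec V m → V} → PCSF⁻ t → PCSF⁻ (λ as → ⋃ (t as))
  unionC = comp₁ (union⁻ (λ _ → refl))

  opairC : ∀ {m} {t u : Vec V m → V} → PCSF⁻ t → PCSF⁻ u → PCSF⁻ (λ as → opair (t as) (u as))
  opairC pt pu = pairC (pairC pt pt) (pairC pt pu)

  adjoinC : ∀ {m} {t u : Vec V m → V} → PCSF⁻ t → PCSF⁻ u → PCSF⁻ (λ as → adjoin (t as) (u as))
  adjoinC pt pu = unionC (pairC pt (pairC pu pu))

  testC : ∀ {m} {t u : Vec V m → V} → PCSF⁻ t → PCSF⁻ u → PCSF⁻ (λ as → test (t as) (u as))
  testC = comp₄ (cond⁻ (λ _ _ _ _ → refl)) (pairC nullC nullC) nullC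

  sepMember⁻ : ∀ {m} {f t u : Vec V (sucℕ m) → V} → PCSF⁻ t → PCSF⁻ u →
               (∀ as c → f (as ∷ʳ c) ≡ sep c (λ b → t (as ∷ʳ b) ∈ u (as ∷ʳ b))) → PCSF⁻ f
  sepMember⁻ pt pu f≡ =
    sep⁻ (testC pt pu) (λ as c → trans (f≡ as c) (sep-cong (λ _ → test-≢∅) (λ _ → test-≢∅⇒∈)))

  sepInhabited⁻ : ∀ {m} {f s : Vec V (sucℕ m) → V} → PCSF⁻ s →
                  (∀ as c → f (as ∷ʳ c) ≡ sep c (λ b → Σ V λ w → w ∈ s (as ∷ʳ b))) → PCSF⁻ f
  sepInhabited⁻ {s = s} ps f≡ =
    sep⁻ ps (λ as c → trans (f≡ as c)
      (sep-cong (λ _ (w , w∈) → member⇒≢∅ w∈) (λ b → ≢∅⇒member (s (as ∷ʳ b)))))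

  secondsIn : V → V → V → V
  secondsIn b c e = sep e (λ d → opair c d ∈ b)

  appP : PCSF⁻ (fun₂ app)
  appP = resp⁻ (unionC (comp₃ secondsInP (arg zero) (arg (suc zero)) (unionC (unionC (arg zero)))))
               (λ { (b ∷ c ∷ []) → refl })
    where
      secondsInP : PCSF⁻ (fun₃ secondsIn)
      secondsInP = sepMember⁻ (opairC (arg (suc zero)) (arg (suc (suc zero)))) (arg zero)
                              (λ { (b ∷ c ∷ []) e → refl })

  appC : ∀ {m} {t u : Vec V m → V} → PCSF⁻ t → PCSF⁻ u → PCSF⁻ (λ as → app (t as) (u as))
  appC = comp₂ appP

  -- domFilter y U: the elements p ∈ U having some {w} ∈ p with w ∈ y, i.e. for a set of
  -- Kuratowski pairs, those whose first coordinate lies in y.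
  domFilter : V → V → V
  domFilter y U = sep U (λ p → Σ V λ w → w ∈ sep y (λ w → pair w w ∈ p))

  domFilterP : PCSF⁻ (fun₂ domFilter)
  domFilterP = sepInhabited⁻ (comp₂ singletonsInP (arg (suc zero)) (arg zero))
                             (λ { (y ∷ []) U → refl })
    where
      singletonsInP : PCSF⁻ (fun₂ (λ p y → sep y (λ w → pair w w ∈ p)))
      singletonsInP = sepMember⁻ (pairC (arg (suc zero)) (arg (suc zero))) (arg zero)
                                 (λ { (p ∷ []) y → refl })

  fiber : V → V → V → V
  fiber R d x = sep x (λ w → opair w d ∈ R)

  imageWithin : V → V → V → V
  imageWithin x R e = sep e (λ d → Σ V λ w → w ∈ fiber R d x)

  relImage : V → V → V
  relImage x R = imageWithin x R (⋃ (⋃ R))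

  relImageP : PCSF⁻ (fun₂ relImage)
  relImageP = resp⁻ (comp₃ imageWithinP (arg zero) (arg (suc zero)) (unionC (unionC (arg (suc zero)))))
                    (λ { (x ∷ R ∷ []) → refl })
    where
      fiberP : PCSF⁻ (fun₃ fiber)
      fiberP = sepMember⁻ (opairC (arg (suc (suc zero))) (arg (suc zero))) (arg zero)
                          (λ { (R ∷ d ∷ []) x → refl })
      imageWithinP : PCSF⁻ (fun₃ imageWithin)
      imageWithinP = sepInhabited⁻ (comp₃ fiberP (arg (suc zero)) (arg (suc (suc zero))) (arg zero))
                                   (λ { (x ∷ R ∷ []) e → refl })

  entry : V → V → V
  entry a z = opair z (app a z)

  domFilter-entries : ∀ a y U → (∀ p → p ∈ U → Σ V λ w → p ≡ entry a w) →
                      (∀ z → z ∈ y → entry a z ∈ U) → domFilter y U ≡ restrict y a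
  domFilter-entries a y U onlyEntries covers = ext′ to from
    where
      to : ∀ p → p ∈ domFilter y U → p ∈ restrict y a
      to p p∈ with sepE p∈
      ... | p∈U , (w , w∈) with sepE w∈ | onlyEntries p p∈U
      ...   | w∈y , singleton∈p | w′ , refl with singleton∈opair {w} {w′} {app a w′} singleton∈p
      ...     | refl = replI w∈y
      from : ∀ p → p ∈ restrict y a → p ∈ domFilter y U
      from p p∈ with replE p∈
      ... | w , w∈y , refl = sepI (covers w w∈y) (w , sepI w∈y pairI₁)

  restrictStep : V → V → V → V
  restrictStep x a S = domFilter (succ x) (adjoin (⋃ S) (entry a x))

  restrict-succ-step : ∀ x a → restrict (succ x) a ≡ restrictStep x a (repl (λ z → restrict (succ z) a) x)
  restrict-succ-step x a = sym (domFilter-entries a (succ x) _ onlyEntries covers)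
    where
      onlyEntries : ∀ p → p ∈ adjoin (⋃ (repl (λ z → restrict (succ z) a) x)) (entry a x) →
                    Σ V λ w → p ≡ entry a w
      onlyEntries p p∈ with adjoinE p∈
      ... | inj₂ p≡ = x , p≡
      ... | inj₁ p∈⋃ with ⋃E p∈⋃
      ...   | r , r∈ , p∈r with replE r∈
      ...     | z , _ , refl with replE p∈r
      ...       | w , _ , p≡ = w , p≡
      covers : ∀ z → z ∈ succ x → entry a z ∈ adjoin (⋃ (repl (λ z → restrict (succ z) a) x)) (entry a x)
      covers z z∈ with adjoinE z∈
      ... | inj₁ z∈x  = adjoinI₁ (⋃I (replI z∈x) (replI adjoinI₂))
      ... | inj₂ refl = adjoinI₂

  restrict-from-succ : ∀ x a → restrict x a ≡ domFilter x (restrict (succ x) a)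
  restrict-from-succ x a = sym (domFilter-entries a x _ (λ p p∈ → let (w , _ , p≡) = replE p∈ in w , p≡)
                                                        (λ z z∈x → replI (adjoinI₁ z∈x)))

  rng-as-image : ∀ x a → rng x a ≡ relImage x (restrict x a)
  rng-as-image x a = ext′ to from
    where
      to : ∀ d → d ∈ rng x a → d ∈ relImage x (restrict x a)
      to d d∈ with replE d∈
      ... | z , z∈x , refl = sepI (⋃I (⋃I (replI z∈x) pairI₂) pairI₂) (z , sepI z∈x (replI z∈x))
      from : ∀ d → d ∈ relImage x (restrict x a) → d ∈ rng x a
      from d d∈ with sepE d∈
      ... | _ , (w , w∈) with replE (proj₂ (sepE w∈))
      ...   | z , z∈x , eq = subst (_∈ rng x a) (sym (opair-inj₂ eq)) (replI z∈x)

  liftN : ∀ {n m} {g : Vec V (n + m) → V} → PCSF⁻ g → PCSF n m (λ xs as → g (xs ++ as))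
  liftN {n} {m} {g} pg =
    scomp {k = 0} {h = λ _ bs → g bs} {rs = λ ()} {ts = λ j xs as → lookup (xs ++ as) j}
      (base pg (λ _ → refl)) (λ ()) (λ j → proj j (λ _ _ → refl))
      (λ xs as → cong g (sym (tabulate∘lookup (xs ++ as))))

  -- (x/a) ↦ g(x, k(x/a)) is in PCSF when g ∈ PCSF⁻ and k ∈ PCSF: x enters g as a safe argument.
  applySafe : ∀ {g : V → V → V} {f k : Vec V 1 → Vec V 1 → V} → PCSF⁻ (fun₂ g) → PCSF 1 1 k →
              (∀ x a → f (x ∷ []) (a ∷ []) ≡ g x (k (x ∷ []) (a ∷ []))) → PCSF 1 1 f
  applySafe {k = k} pg pk f≡ =
    scomp {k = 0} {l = 2} {rs = λ ()} {ts = λ { zero → λ xs as → lookup (xs ++ as) zero ; (suc zero) → k }}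
      (liftN pg) (λ ()) (λ { zero → proj zero (λ _ _ → refl) ; (suc zero) → pk })
      (λ { (x ∷ []) (a ∷ []) → f≡ x a })

  restrictSucc : Vec V 1 → Vec V 1 → V
  restrictSucc (x ∷ []) (a ∷ []) = restrict (succ x) a

  restrictSuccP : PCSF 1 1 restrictSucc
  restrictSuccP = rec (liftN restrictStepP) (λ { x [] (a ∷ []) → restrict-succ-step x a })
    where
      entryC : PCSF⁻ (λ (as : Vec V 3) → entry (lookup as (suc zero)) (lookup as zero))
      entryC = opairC (arg zero) (appC (arg (suc zero)) (arg zero))
      restrictStepP : PCSF⁻ (fun₃ restrictStep)
      restrictStepP =
        resp⁻ (comp₂ domFilterP (adjoinC (arg zero) (arg zero)) (adjoinC (unionC (arg (suc (suc zero)))) entryC))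
              (λ { (x ∷ a ∷ S ∷ []) → refl })

  restrictP : PCSF 1 1 restrictF
  restrictP = applySafe domFilterP restrictSuccP restrict-from-succ

  rngP : PCSF 1 1 rngF
  rngP = applySafe relImageP restrictP rng-as-image

proposition3p2p10 : ∀ {ℓ : Level} (M : SetModel ℓ) →
    Sets.PCSF M 1 1 (Sets.restrictF M) × Sets.PCSF M 1 1 (Sets.rngF M)
proposition3p2p10 M = restrictP , rngP
  where open Construction M
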